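{- Let $n\in\mathbb{N}$, let $E_0,\dots,E_{n-1}$ be pairwise disjoint sets with $E=\bigcup_{i<n}E_i$, let $U_i$ be a uniform matroid on $E_i$ for each $i<n$, let $N=\bigoplus_{i<n}U_i$, and let $M$ be any matroid on $E$. Let $I\in\mathcal{I}_M\cap\mathcal{I}_N$. Then $I$ is $\subseteq$-maximal in $\mathcal{I}_M\cap\mathcal{I}_N$ if and only if for every $i<n$ we have $E_i\subseteq\mathsf{span}_M(I)$ or $E_i\subseteq\mathsf{span}_N(I)$.
   Context: Matroids are possibly infinite (B-)matroids: a matroid on $E$ is a pair $(E,\mathcal{I})$ with $\mathcal{I}\subseteq\mathcal{P}(E)$ such that (i) $\varnothing\in\mathcal{I}$; (ii) $\mathcal{I}$ is closed under subsets; (iii) for all $I,J\in\mathcal{I}$ with $J$ $\subseteq$-maximal in $\mathcal{I}$ and $I$ not maximal, there is $e\in J\setminus I$ with $I\cup\{e\}\in\mathcal{I}$; (iv) for every $X\subseteq E$, every $I\in\mathcal{I}$ with $I\subseteq X$ extends to a $\subseteq$-maximal element of $\{J\in\mathcal{I}:J\subseteq X\}$. $\mathcal{I}_M$ denotes the set of independent sets of $M$. For $X\subseteq E$, $\mathsf{span}_M(X)$ consists of $X$ together with all $e\in E\setminus X$ such that $B_X\cup\{e\}$ is dependent in $M$, where $B_X$ is a maximal $M$-independent subset of $X$. A matroid $(E,\mathcal{I})$ is uniform if for every $I\in\mathcal{I}$, $e\in I$ and $f\in E\setminus I$ we have $(I\setminus\{e\})\cup\{f\}\in\mathcal{I}$.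 The direct sum $\bigoplus_i U_i$ is the matroid on $\bigcup_i E_i$ in which $I$ is independent iff $I\cap E_i$ is independent in $U_i$ for all $i$. -}

module Defs where

open import Level using (Level; 0ℓ; suc; Lift)
open import Data.Nat using (ℕ)
open import Data.Fin using (Fin)
open import Data.Empty using (⊥)
open import Data.Product using (Σ; Σ-syntax; _×_; _,_)
open import Data.Sum using (_⊎_)
open import Relation.Nullary using (¬_)
open import Relation.Binary.PropositionalEquality using (_≡_)

Subset : Set → Set₁
Subset E = E → Set

module _ {E : Set} where

  _∈_ : E → Subset E → Set
  x ∈ X = X x

  _⊆_ : Subset E → Subset E → Set
  X ⊆ Y = ∀ x → X x → Y x

  ∅ : Subset E
  ∅ _ = ⊥

  _+ₑ_ : Subset E → E → Subset E
  (X +ₑ e) x = X x ⊎ x ≡ e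

  _-ₑ_ : Subset E → E → Subset E
  (X -ₑ e) x = X x × ¬ (x ≡ e)

  Maximal : (Subset E → Set) → Subset E → Set₁
  Maximal 𝓕 J = 𝓕 J × (∀ K → 𝓕 K → J ⊆ K → K ⊆ J)

  IndepIn : (Subset E → Set) → Subset E → Subset E → Set
  IndepIn 𝓘 X J = 𝓘 J × J ⊆ X

  span : (Subset E → Set) → Subset E → E → Set₁
  span 𝓘 X e = Lift (suc 0ℓ) (X e) ⊎ Σ[ B ∈ Subset E ] (Maximal (IndepIn 𝓘 X) B × ¬ 𝓘 (B +ₑ e))

-- (possibly infinite) matroid on the type E, given by its independent sets
record Matroid (E : Set) : Set₁ where
  field
    Indep   : Subset E → Set
    indep-∅ : Indep ∅
    indep-⊆ : ∀ I J → Indep I → J ⊆ I → Indep J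
    augment : ∀ I J → Indep I → ¬ Maximal Indep I → Maximal Indep J →
              Σ[ e ∈ E ] (J e × ¬ I e × Indep (I +ₑ e))
    maximal : ∀ X I → Indep I → I ⊆ X →
              Σ[ B ∈ Subset E ] (Maximal (IndepIn Indep X) B × I ⊆ B)
open Matroid public

IsUniform : {E : Set} → Matroid E → Set₁
IsUniform {E} M = ∀ I e f → Indep M I → I e → ¬ I f → Indep M ((I -ₑ e) +ₑ f)

-- independent sets of the direct sum ⊕_{i<n} U i on the disjoint union Σ (Fin n) E
DirectSumIndep : {n : ℕ} {E : Fin n → Set} → ((i : Fin n) → Matroid (E i)) →
                 Subset (Σ (Fin n) E) → Set
DirectSumIndep U I = ∀ i → Indep (U i) (λ x → I (i , x))

module Submission where

-- If some x ∈ E_i is outside span_M(I), then I + x is M-independent, so maximality forces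
-- I + x to be N-dependent. Were some y ∈ E_i ∖ I outside span_N(I), the uniform matroid U_i
-- would let us exchange y for x in I + y, making I + x N-independent after all. Conversely,
-- an element spanned by I in either matroid cannot be added to I while keeping independence
-- in that matroid, so a common independent superset of I adds nothing.

open import Defs
open import Level using (Level; 0ℓ; _⊔_; lift)
open import Axiom.ExcludedMiddle using (ExcludedMiddle)
open import Axiom.DoubleNegationElimination using (em⇒dne)
open import Axiom.UniquenessOfIdentityProofs using (module Decidable⇒UIP)
open import Data.Nat using (ℕ)
open import Data.Fin using (Fin)
open import Data.Fin.Properties using (_≟_)
open import Data.Product using (Σ; ∃; _×_; _,_; proj₁; proj₂)
open import Data.Product.Properties using (,-injectiveʳ-UIP)
open import Data.Sum using (_⊎_; inj₁; inj₂)
open import Data.Empty using (⊥-elim)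
open import Function.Bundles using (_⇔_; mk⇔)
open import Relation.Nullary using (¬_; yes; no; contradiction)
open import Relation.Nullary.Negation using (¬∃⟶∀¬)
open import Relation.Binary.PropositionalEquality using (_≡_; _≢_; refl; cong)

∀⊎∃¬ : ∀ {a p} → ExcludedMiddle (a ⊔ p) → ExcludedMiddle p →
       {A : Set a} (P : A → Set p) → (∀ x → P x) ⊎ ∃ λ x → ¬ P x
∀⊎∃¬ em₁ em₂ P with em₁ {∃ λ x → ¬ P x}
... | yes ∃¬P = inj₂ ∃¬P
... | no ¬∃¬P = inj₁ λ x → em⇒dne em₂ (¬∃⟶∀¬ ¬∃¬P x)

module _ {T : Set} (𝓘 : Subset T → Set) where

  DownClosed : Set₁
  DownClosed = ∀ I J → 𝓘 I → J ⊆ I → 𝓘 J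

  maximal-in-self : ∀ {I} → 𝓘 I → Maximal (IndepIn 𝓘 I) I
  maximal-in-self 𝓘I = (𝓘I , λ _ x → x) , λ _ K _ → proj₂ K

  dependent⇒∈span : ∀ {I e} → 𝓘 I → ¬ 𝓘 (I +ₑ e) → span 𝓘 I e
  dependent⇒∈span 𝓘I ¬𝓘I+e = inj₂ (_ , maximal-in-self 𝓘I , ¬𝓘I+e)

  ∈span⊎indep-+ₑ : ExcludedMiddle 0ℓ → ∀ {I e} → 𝓘 I → span 𝓘 I e ⊎ 𝓘 (I +ₑ e)
  ∈span⊎indep-+ₑ em {I} {e} 𝓘I with em {𝓘 (I +ₑ e)}
  ... | yes 𝓘I+e = inj₂ 𝓘I+e
  ... | no ¬𝓘I+e = inj₁ (dependent⇒∈span 𝓘I ¬𝓘I+e)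

  ∈span∩indep-superset⇒∈ : DownClosed → ∀ {I J e} →
    span 𝓘 I e → 𝓘 J → I ⊆ J → J e → I e
  ∈span∩indep-superset⇒∈ _ (inj₁ (lift Ie)) _ _ _ = Ie
  ∈span∩indep-superset⇒∈ down {J = J} (inj₂ (B , ((_ , B⊆I) , _) , ¬𝓘B+e)) 𝓘J I⊆J Je =
    ⊥-elim (¬𝓘B+e (down J _ 𝓘J λ { z (inj₁ Bz) → I⊆J z (B⊆I z Bz) ; _ (inj₂ refl) → Je }))

uniform-replace : ExcludedMiddle 0ℓ → {F : Set} (U : Matroid F) → IsUniform U →
  ∀ {I x y} → Indep U (I +ₑ y) → ¬ I y → ¬ I x → Indep U (I +ₑ x)
uniform-replace em U uniform {I} {x} {y} U[I+y] ¬Iy ¬Ix with em {x ≡ y}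
... | yes refl = U[I+y]
... | no x≢y = indep-⊆ U _ _ (uniform _ y x U[I+y] (inj₂ refl) x∉I+y) I+x⊆I+y-y+x
  where
  x∉I+y : ¬ (I +ₑ y) x
  x∉I+y (inj₁ Ix) = ¬Ix Ix
  x∉I+y (inj₂ x≡y) = x≢y x≡y

  I+x⊆I+y-y+x : (I +ₑ x) ⊆ (((I +ₑ y) -ₑ y) +ₑ x)
  I+x⊆I+y-y+x z (inj₁ Iz) = inj₁ (inj₁ Iz , λ { refl → ¬Iy Iz })
  I+x⊆I+y-y+x _ (inj₂ z≡x) = inj₂ z≡x

module _ {n : ℕ} {E : Fin n → Set} (U : (i : Fin n) → Matroid (E i)) where

  component : Subset (Σ (Fin n) E) → (i : Fin n) → Subset (E i)
  component I i x = I (i , x)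

  DirectSumIndep-downClosed : DownClosed (DirectSumIndep U)
  DirectSumIndep-downClosed I J N[I] J⊆I i = indep-⊆ (U i) _ _ (N[I] i) λ z → J⊆I (i , z)

  component-+ₑ-⊆ : ∀ I {i} x → component (I +ₑ (i , x)) i ⊆ (component I i +ₑ x)
  component-+ₑ-⊆ I x z (inj₁ Iz) = inj₁ Iz
  component-+ₑ-⊆ I x z (inj₂ eq) = inj₂ (,-injectiveʳ-UIP (Decidable⇒UIP.≡-irrelevant _≟_) eq)

  component-+ₑ-⊇ : ∀ I {i} x → (component I i +ₑ x) ⊆ component (I +ₑ (i , x)) i
  component-+ₑ-⊇ I x z (inj₁ Iz) = inj₁ Iz
  component-+ₑ-⊇ I x _ (inj₂ refl) = inj₂ refl

  component-+ₑ-other : ∀ I {i j} x → j ≢ i → component (I +ₑ (i , x)) j ⊆ component I j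
  component-+ₑ-other I x j≢i z (inj₁ Iz) = Iz
  component-+ₑ-other I x j≢i z (inj₂ eq) = contradiction (cong proj₁ eq) j≢i

  DirectSumIndep-+ₑ : ∀ {I i x} → DirectSumIndep U I → Indep (U i) (component I i +ₑ x) →
                      DirectSumIndep U (I +ₑ (i , x))
  DirectSumIndep-+ₑ {I} {i} {x} N[I] Uᵢ[Iᵢ+x] j with j ≟ i
  ... | yes refl = indep-⊆ (U i) _ _ Uᵢ[Iᵢ+x] (component-+ₑ-⊆ I x)
  ... | no j≢i = indep-⊆ (U j) _ _ (N[I] j) (component-+ₑ-other I x j≢i)

  DirectSumIndep-+ₑ⁻¹ : ∀ {I i x} → DirectSumIndep U (I +ₑ (i , x)) →
                        Indep (U i) (component I i +ₑ x)
  DirectSumIndep-+ₑ⁻¹ {I} {i} {x} N[I+x] = indep-⊆ (U i) _ _ (N[I+x] i) (component-+ₑ-⊇ I x)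

  DirectSumIndep-replace : ExcludedMiddle 0ℓ → (∀ i → IsUniform (U i)) →
    ∀ {I i x y} → DirectSumIndep U I → DirectSumIndep U (I +ₑ (i , y)) →
    ¬ I (i , y) → ¬ I (i , x) → DirectSumIndep U (I +ₑ (i , x))
  DirectSumIndep-replace em uniform {i = i} N[I] N[I+y] ¬Iy ¬Ix =
    DirectSumIndep-+ₑ N[I]
      (uniform-replace em (U i) (uniform i) (DirectSumIndep-+ₑ⁻¹ N[I+y]) ¬Iy ¬Ix)

module _ {n : ℕ} {E : Fin n → Set} (U : (i : Fin n) → Matroid (E i))
         (M : Matroid (Σ (Fin n) E)) (I : Subset (Σ (Fin n) E)) where

  CommonIndep : Subset (Σ (Fin n) E) → Set
  CommonIndep J = Indep M J × DirectSumIndep U J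

  SpannedComponent : Fin n → Set₁
  SpannedComponent i = ((x : E i) → span (Indep M) I (i , x))
                     ⊎ ((x : E i) → span (DirectSumIndep U) I (i , x))

  spanned⇒maximal : CommonIndep I → (∀ i → SpannedComponent i) → Maximal CommonIndep I
  spanned⇒maximal common spanned = common , no-proper-extension
    where
    no-proper-extension : ∀ J → CommonIndep J → I ⊆ J → J ⊆ I
    no-proper-extension J (M[J] , N[J]) I⊆J (i , x) Jx with spanned i
    ... | inj₁ spanM = ∈span∩indep-superset⇒∈ (Indep M) (indep-⊆ M) (spanM x) M[J] I⊆J Jx
    ... | inj₂ spanN =
      ∈span∩indep-superset⇒∈ (DirectSumIndep U) (DirectSumIndep-downClosed U) (spanN x) N[J] I⊆J Jx

  maximal⇒spanned : (∀ {ℓ} → ExcludedMiddle ℓ) → (∀ i → IsUniform (U i)) →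
                    Maximal CommonIndep I → ∀ i → SpannedComponent i
  maximal⇒spanned em uniform ((M[I] , N[I]) , maximal) i
    with ∀⊎∃¬ em em (λ x → span (Indep M) I (i , x))
  ... | inj₁ spanM = inj₁ spanM
  ... | inj₂ (x , x∉spanM) = inj₂ spanN
    where
    ¬Ix : ¬ I (i , x)
    ¬Ix Ix = x∉spanM (inj₁ (lift Ix))

    M[I+x] : Indep M (I +ₑ (i , x))
    M[I+x] with ∈span⊎indep-+ₑ (Indep M) em M[I]
    ... | inj₁ x∈spanM = contradiction x∈spanM x∉spanM
    ... | inj₂ M[I+x] = M[I+x]

    ¬N[I+x] : ¬ DirectSumIndep U (I +ₑ (i , x))
    ¬N[I+x] N[I+x] = ¬Ix (maximal _ (M[I+x] , N[I+x]) (λ _ → inj₁) _ (inj₂ refl))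

    spanN : (y : E i) → span (DirectSumIndep U) I (i , y)
    spanN y with em {P = I (i , y)}
    ... | yes Iy = inj₁ (lift Iy)
    ... | no ¬Iy with ∈span⊎indep-+ₑ (DirectSumIndep U) em N[I]
    ...   | inj₁ y∈spanN = y∈spanN
    ...   | inj₂ N[I+y] = contradiction (DirectSumIndep-replace U em uniform N[I] N[I+y] ¬Iy ¬Ix) ¬N[I+x]

lemma3p3 : (∀ {ℓ : Level} → ExcludedMiddle ℓ) →
    (n : ℕ) (E : Fin n → Set) (U : (i : Fin n) → Matroid (E i)) →
    ((i : Fin n) → IsUniform (U i)) →
    (M : Matroid (Σ (Fin n) E)) (I : Subset (Σ (Fin n) E)) →
    Indep M I → DirectSumIndep U I →
    Maximal (λ J → Indep M J × DirectSumIndep U J) I ⇔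
      ((i : Fin n) →
        ((x : E i) → span (Indep M) I (i , x))
        ⊎ ((x : E i) → span (DirectSumIndep U) I (i , x)))
lemma3p3 em n E U uniform M I M[I] N[I] =
  mk⇔ (maximal⇒spanned U M I em uniform) (spanned⇒maximal U M I (M[I] , N[I]))
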